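{- For each fixed integer $\ell\ge1$, the class of $\ell$-interval graphs is factorial.
   Context: A graph is an $\ell$-interval graph if each vertex $v$ can be assigned a union $f(v)$ of $\ell$ closed real intervals such that distinct $u,v$ are adjacent iff $f(u)\cap f(v)\neq\emptyset$. For a graph class $\mathcal{C}$, $\mathcal{C}^n$ is the set of graphs in $\mathcal{C}$ with vertex set $\{1,\dots,n\}$; $\mathcal{C}$ is factorial if there are constants $c_1,c_2>0$ with $n^{c_1n}\le|\mathcal{C}^n|\le n^{c_2n}$ (for all sufficiently large $n$).
   Formalization: The closed intervals assigned to the vertices have rational endpoints instead of real ones, and the constants $c_1,c_2$ are taken rational. -}

module Defs where

open import Data.Nat using (ℕ; _≤_; _^_; _*_)
open import Data.Fin using (Fin)
open import Data.Bool using (Bool; true; false)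
open import Data.Rational as ℚ using (ℚ)
open import Data.Product using (Σ; ∃; _×_; _,_; proj₁)
open import Relation.Binary.PropositionalEquality using (_≡_; _≢_)
open import Relation.Nullary using (¬_)
open import Function.Bundles using (_⇔_)

record Graph (n : ℕ) : Set where
  field
    adj    : Fin n → Fin n → Bool
    sym    : ∀ i j → adj i j ≡ adj j i
    irrefl : ∀ i → adj i i ≡ false
open Graph public

_≈G_ : ∀ {n} → Graph n → Graph n → Set
G ≈G H = ∀ i j → adj G i j ≡ adj H i j

record Interval : Set where
  field
    lo   : ℚ
    hi   : ℚ
    lo≤hi : lo ℚ.≤ hi
open Interval public

_∈I_ : ℚ → Interval → Set
x ∈I I = (lo I ℚ.≤ x) × (x ℚ.≤ hi I)

IntervalUnion : ℕ → Set
IntervalUnion ℓ = Fin ℓ → Interval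

_∈U_ : ∀ {ℓ} → ℚ → IntervalUnion ℓ → Set
x ∈U U = ∃ λ i → x ∈I U i

Meets : ∀ {ℓ} → IntervalUnion ℓ → IntervalUnion ℓ → Set
Meets U V = ∃ λ x → (x ∈U U) × (x ∈U V)

IsIntervalGraph : (ℓ : ℕ) → (n : ℕ) → Graph n → Set
IsIntervalGraph ℓ n G =
  Σ (Fin n → IntervalUnion ℓ) λ f →
    ∀ u v → u ≢ v → (adj G u v ≡ true) ⇔ Meets (f u) (f v)

GraphClass : Set₁
GraphClass = (n : ℕ) → Graph n → Set

ClassN : GraphClass → ℕ → Set
ClassN 𝒞 n = Σ (Graph n) (𝒞 n)

Tuples : GraphClass → ℕ → ℕ → Set
Tuples 𝒞 n q = Fin q → ClassN 𝒞 n

TupleEq : ∀ 𝒞 n q → Tuples 𝒞 n q → Tuples 𝒞 n q → Set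
TupleEq 𝒞 n q s t = ∀ k → proj₁ (s k) ≈G proj₁ (t k)

-- |𝒞ⁿ|^q ≥ m : an injection Fin m → (𝒞ⁿ)^q.
PowAtLeast : GraphClass → (n q m : ℕ) → Set
PowAtLeast 𝒞 n q m =
  Σ (Fin m → Tuples 𝒞 n q) λ g → ∀ a b → TupleEq 𝒞 n q (g a) (g b) → a ≡ b

-- |𝒞ⁿ|^q ≤ m : an injection (𝒞ⁿ)^q → Fin m.
PowAtMost : GraphClass → (n q m : ℕ) → Set
PowAtMost 𝒞 n q m =
  Σ (Tuples 𝒞 n q → Fin m) λ h → ∀ s t → h s ≡ h t → TupleEq 𝒞 n q s t

-- 𝒞 is factorial: there are positive rational constants c₁ = p₁/q₁ and
-- c₂ = p₂/q₂ with n^(c₁ n) ≤ |𝒞ⁿ| ≤ n^(c₂ n) for all sufficiently large n.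
-- n^((p/q) n) ≤ |𝒞ⁿ|  ⇔  n^(p n) ≤ |𝒞ⁿ|^q , and similarly for the upper bound.
Factorial : GraphClass → Set
Factorial 𝒞 =
  Σ ℕ λ p₁ → Σ ℕ λ q₁ → Σ ℕ λ p₂ → Σ ℕ λ q₂ →
    (1 ≤ p₁) × (1 ≤ q₁) × (1 ≤ p₂) × (1 ≤ q₂) ×
    Σ ℕ λ N₀ → ∀ n → N₀ ≤ n →
      PowAtLeast 𝒞 n q₁ (n ^ (p₁ * n)) × PowAtMost 𝒞 n q₂ (n ^ (p₂ * n))

{-# OPTIONS --safe #-}
-- Upper bound: replacing every endpoint of an ℓ-interval representation by its rank,
-- the number of the 2ℓn endpoints strictly below it, preserves all comparisons between
-- endpoints and hence the graph. So a graph is determined by a map from its 2ℓn endpoints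
-- to {0, …, 2ℓn}, and there are at most (2ℓn + 1)^(2ℓn) ≤ n^(4ℓn) graphs once n > 2ℓ.
--
-- Lower bound: a map g from m vertices to k further vertices is recovered from the graph
-- in which each of the k vertices is its own point on the line, each of the m vertices sits
-- at the point of its image, and vertices are adjacent when their points coincide. This is
-- an interval graph, even with degenerate intervals, and the split m = ⌊n/2⌋, k = ⌈n/2⌉
-- gives k^m ≥ n^(n/6) of them.
module Submission where

open import Defs
open import Data.Nat
open import Data.Nat.Properties
open import Algebra.Definitions.RawMonoid +-0-rawMonoid using (sum)
open import Data.Fin as Fin using (Fin; zero; suc; toℕ; fromℕ<; inject≤; _↑ˡ_; _↑ʳ_; splitAt; combine; funToFin; finToFun)
open import Data.Fin.Properties using (toℕ-injective; fromℕ<-injective; inject≤-injective; splitAt-↑ˡ; splitAt-↑ʳ; funToFin-finToFin; finToFun-funToFin)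
open import Data.Rational as ℚ using (ℚ; mkℚ+)
import Data.Rational.Properties as ℚ
open import Data.Nat.Coprimality as Coprime using ()
open import Data.Product using (∃₂; _×_; _,_; proj₁)
open import Data.Sum using (inj₁; inj₂; [_,_]′)
open import Data.Bool using (true; not; _∧_)
open import Data.Bool.Properties using (⇔→≡)
open import Data.Empty using (⊥-elim)
open import Function using (_∘_; id)
open import Function.Bundles using (_⇔_; mk⇔; Equivalence)
import Function.Properties.Equivalence as ⇔
open import Relation.Nullary using (Dec; yes; no; does)
open import Relation.Nullary.Decidable using (dec-true; dec-false; does-⇔)
open import Relation.Binary.PropositionalEquality as ≡ using (_≡_; _≢_; _≗_; refl; cong; cong₂; subst; subst₂)

private
  variable
    ℓ m n k q M : ℕ
    𝒞 : GraphClass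

funToFin-cong : {g h : Fin m → Fin k} → g ≗ h → funToFin g ≡ funToFin h
funToFin-cong {zero} _ = refl
funToFin-cong {suc m} g≗h = cong₂ combine (g≗h zero) (funToFin-cong (g≗h ∘ suc))

funToFin-injective : {g h : Fin m → Fin k} → funToFin g ≡ funToFin h → g ≗ h
funToFin-injective {g = g} {h} eq i = begin
  g i                      ≡⟨ finToFun-funToFin g i ⟨
  finToFun (funToFin g) i  ≡⟨ cong (λ c → finToFun c i) eq ⟩
  finToFun (funToFin h) i  ≡⟨ finToFun-funToFin h i ⟩
  h i                      ∎
  where open ≡.≡-Reasoning

finToFun-injective : {a b : Fin (k ^ m)} → finToFun {k} {m} a ≗ finToFun b → a ≡ b
finToFun-injective {k} {m} {a} {b} eq = begin
  a                              ≡⟨ funToFin-finToFin {m} {k} a ⟨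
  funToFin {m} {k} (finToFun a)  ≡⟨ funToFin-cong eq ⟩
  funToFin {m} {k} (finToFun b)  ≡⟨ funToFin-finToFin {m} {k} b ⟩
  b                              ∎
  where open ≡.≡-Reasoning

PowAtLeast-mono : M ≤ k → PowAtLeast 𝒞 n q k → PowAtLeast 𝒞 n q M
PowAtLeast-mono M≤k (g , g-inj) =
  (λ a → g (inject≤ a M≤k)) , λ a b eq → inject≤-injective M≤k M≤k a b (g-inj _ _ eq)

PowAtLeast-fromFunctions : (φ : (Fin m → Fin k) → ClassN 𝒞 n) →
  (∀ g h → proj₁ (φ g) ≈G proj₁ (φ h) → g ≗ h) → PowAtLeast 𝒞 n q ((k ^ m) ^ q)
PowAtLeast-fromFunctions {m} {k} {q = q} φ φ-inj =
  (λ a j → φ (finToFun (finToFun a j))) ,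
  λ a b eq → finToFun-injective {k ^ m} {q} λ j → finToFun-injective {k} {m} (φ-inj _ _ (eq j))

PowAtMost-mono : k ≤ M → PowAtMost 𝒞 n q k → PowAtMost 𝒞 n q M
PowAtMost-mono k≤M (h , h-inj) =
  (λ s → inject≤ (h s) k≤M) , λ s t eq → h-inj s t (inject≤-injective k≤M k≤M _ _ eq)

PowAtMost-fromCode : (code : ClassN 𝒞 n → Fin M) →
  (∀ G H → code G ≡ code H → proj₁ G ≈G proj₁ H) → PowAtMost 𝒞 n 1 M
PowAtMost-fromCode code code-inj = (λ s → code (s zero)) , λ { s t eq zero → code-inj _ _ eq }

sum-mono-≤ : {s t : Fin m → ℕ} → (∀ i → s i ≤ t i) → sum s ≤ sum t
sum-mono-≤ {zero} _ = z≤n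
sum-mono-≤ {suc m} s≤t = +-mono-≤ (s≤t zero) (sum-mono-≤ (s≤t ∘ suc))

sum-mono-< : {s t : Fin m → ℕ} → (∀ i → s i ≤ t i) → ∀ i → s i < t i → sum s < sum t
sum-mono-< s≤t zero s<t = +-mono-<-≤ s<t (sum-mono-≤ (s≤t ∘ suc))
sum-mono-< s≤t (suc i) s<t = +-mono-≤-< (s≤t zero) (sum-mono-< (s≤t ∘ suc) i s<t)

sum-bounded : {s : Fin m → ℕ} → ∀ c → (∀ i → s i ≤ c) → sum s ≤ m * c
sum-bounded {zero} c _ = z≤n
sum-bounded {suc m} c s≤c = +-mono-≤ (s≤c zero) (sum-bounded c (s≤c ∘ suc))

[_<_] : ℚ → ℚ → ℕ
[ a < x ] with a ℚ.<? x
... | yes _ = 1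
... | no _ = 0

[<]-monoʳ : ∀ a {x y} → x ℚ.≤ y → [ a < x ] ≤ [ a < y ]
[<]-monoʳ a {x} {y} x≤y with a ℚ.<? x | a ℚ.<? y
... | yes _ | yes _ = ≤-refl
... | yes a<x | no a≮y = ⊥-elim (a≮y (ℚ.<-≤-trans a<x x≤y))
... | no _ | _ = z≤n

[<]-strict : ∀ {a x} → a ℚ.< x → [ a < a ] < [ a < x ]
[<]-strict {a} {x} a<x with a ℚ.<? a | a ℚ.<? x
... | yes a<a | _ = ⊥-elim (ℚ.<-irrefl refl a<a)
... | no _ | yes _ = z<s
... | no _ | no a≮x = ⊥-elim (a≮x a<x)

[<]≤1 : ∀ a x → [ a < x ] ≤ 1
[<]≤1 a x with a ℚ.<? x
... | yes _ = ≤-refl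
... | no _ = z≤n

endpoint : Interval → Fin 2 → ℚ
endpoint I zero = lo I
endpoint I (suc zero) = hi I

Overlap : Interval → Interval → Set
Overlap I J = lo I ℚ.≤ hi J × lo J ℚ.≤ hi I

Meets⇔Overlap : {U V : IntervalUnion ℓ} → Meets U V ⇔ ∃₂ λ i j → Overlap (U i) (V j)
Meets⇔Overlap {U = U} {V} = mk⇔
  (λ (x , (i , lo≤x , x≤hi) , (j , lo′≤x , x≤hi′)) →
    i , j , ℚ.≤-trans lo≤x x≤hi′ , ℚ.≤-trans lo′≤x x≤hi)
  λ (i , j , I∩J) → meet i j I∩J
  where
  meet : ∀ i j → Overlap (U i) (V j) → Meets U V
  meet i j (p , q) with ℚ.≤-total (lo (U i)) (lo (V j))
  ... | inj₁ lo≤lo′ = lo (V j) , (i , lo≤lo′ , q) , (j , ℚ.≤-refl , lo≤hi (V j))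
  ... | inj₂ lo′≤lo = lo (U i) , (i , ℚ.≤-refl , lo≤hi (U i)) , (j , lo′≤lo , p)

module Rank (f : Fin n → IntervalUnion ℓ) where

  endpoints : Fin n → Fin ℓ → Fin 2 → ℚ
  endpoints u i = endpoint (f u i)

  below : ℚ → Fin n → Fin ℓ → Fin 2 → ℕ
  below x u i b = [ endpoints u i b < x ]

  below-mono : ∀ {x y} → x ℚ.≤ y → ∀ u i b → below x u i b ≤ below y u i b
  below-mono x≤y u i b = [<]-monoʳ (endpoints u i b) x≤y

  rank : ℚ → ℕ
  rank x = sum λ u → sum λ i → sum (below x u i)

  rank-mono : ∀ {x y} → x ℚ.≤ y → rank x ≤ rank y
  rank-mono x≤y = sum-mono-≤ λ u → sum-mono-≤ λ i → sum-mono-≤ (below-mono x≤y u i)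

  rank-strict : ∀ u i b {x} → endpoints u i b ℚ.< x → rank (endpoints u i b) < rank x
  rank-strict u i b e<x =
    sum-mono-< (λ v → sum-mono-≤ λ j → sum-mono-≤ (below-mono e≤x v j)) u
      (sum-mono-< (λ j → sum-mono-≤ (below-mono e≤x u j)) i
        (sum-mono-< (below-mono e≤x u i) b ([<]-strict e<x)))
    where e≤x = ℚ.<⇒≤ e<x

  rank-reflects-≤ : ∀ u i b {x} → rank x ≤ rank (endpoints u i b) → x ℚ.≤ endpoints u i b
  rank-reflects-≤ u i b {x} rx≤re with x ℚ.≤? endpoints u i b
  ... | yes x≤e = x≤e
  ... | no x≰e = ⊥-elim (<⇒≱ (rank-strict u i b (ℚ.≰⇒> x≰e)) rx≤re)

  rank< : ∀ x → rank x < suc (n * (ℓ * 2))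
  rank< x = s≤s (sum-bounded _ λ u → sum-bounded _ λ i → sum-bounded 1 λ b → [<]≤1 (endpoints u i b) x)

open Rank

SameRanks : (f f′ : Fin n → IntervalUnion ℓ) → Set
SameRanks f f′ = ∀ u i b → rank f (endpoints f u i b) ≡ rank f′ (endpoints f′ u i b)

endpoints-≤-transfer : (f f′ : Fin n → IntervalUnion ℓ) → SameRanks f f′ → ∀ u i a v j b →
  endpoints f u i a ℚ.≤ endpoints f v j b → endpoints f′ u i a ℚ.≤ endpoints f′ v j b
endpoints-≤-transfer f f′ same u i a v j b e≤e′ =
  rank-reflects-≤ f′ v j b (subst₂ _≤_ (same u i a) (same v j b) (rank-mono f e≤e′))

Meets-transfer : (f f′ : Fin n → IntervalUnion ℓ) → SameRanks f f′ → ∀ u v →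
  Meets (f u) (f v) → Meets (f′ u) (f′ v)
Meets-transfer f f′ same u v meets with Equivalence.to (Meets⇔Overlap {U = f u} {f v}) meets
... | i , j , p , q = Equivalence.from (Meets⇔Overlap {U = f′ u} {f′ v})
  (i , j , ≤-transfer u i zero v j (suc zero) p , ≤-transfer v j zero u i (suc zero) q)
  where ≤-transfer = endpoints-≤-transfer f f′ same

Represents : Graph n → (Fin n → IntervalUnion ℓ) → Set
Represents G f = ∀ u v → u ≢ v → (adj G u v ≡ true) ⇔ Meets (f u) (f v)

≈G-fromSameRanks : {G G′ : Graph n} (f f′ : Fin n → IntervalUnion ℓ) →
  Represents G f → Represents G′ f′ → SameRanks f f′ → G ≈G G′
≈G-fromSameRanks {G = G} {G′} f f′ rep rep′ same u v with u Fin.≟ v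
... | yes refl = ≡.trans (irrefl G u) (≡.sym (irrefl G′ u))
... | no u≢v = ⇔→≡ (⇔.trans (rep u v u≢v) (⇔.trans meets⇔meets′ (⇔.sym (rep′ u v u≢v))))
  where
  meets⇔meets′ = mk⇔ (Meets-transfer f f′ same u v)
                      (Meets-transfer f′ f (λ u i b → ≡.sym (same u i b)) u v)

rankPattern : (f : Fin n → IntervalUnion ℓ) → Fin n → Fin ℓ → Fin 2 → Fin (suc (n * (ℓ * 2)))
rankPattern f u i b = fromℕ< (rank< f (endpoints f u i b))

rankCode : (f : Fin n → IntervalUnion ℓ) → Fin (((suc (n * (ℓ * 2)) ^ 2) ^ ℓ) ^ n)
rankCode f = funToFin λ u → funToFin λ i → funToFin (rankPattern f u i)

rankCode-injective : (f f′ : Fin n → IntervalUnion ℓ) → rankCode f ≡ rankCode f′ → SameRanks f f′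
rankCode-injective f f′ eq u i b = fromℕ<-injective _ _ (rank< f _) (rank< f′ _)
  (funToFin-injective {g = rankPattern f u i} {rankPattern f′ u i}
    (funToFin-injective (funToFin-injective eq u) i) b)

intervalGraphs-upperBound-rankCode : PowAtMost (IsIntervalGraph ℓ) n 1 (((suc (n * (ℓ * 2)) ^ 2) ^ ℓ) ^ n)
intervalGraphs-upperBound-rankCode {ℓ} =
  PowAtMost-fromCode {𝒞 = IsIntervalGraph ℓ} (λ (_ , f , _) → rankCode f) λ (G , f , rep) (G′ , f′ , rep′) eq →
    ≈G-fromSameRanks {G = G} {G′} f f′ rep rep′ (rankCode-injective f f′ eq)

rankCodeSize≤ : suc (ℓ * 2) ≤ n → ((suc (n * (ℓ * 2)) ^ 2) ^ ℓ) ^ n ≤ n ^ (4 * ℓ * n)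
rankCodeSize≤ {ℓ} {n} 2ℓ<n = begin
  ((suc (n * (ℓ * 2)) ^ 2) ^ ℓ) ^ n  ≤⟨ ^-monoˡ-≤ n (^-monoˡ-≤ ℓ (^-monoˡ-≤ 2 rank<n²)) ⟩
  (((n ^ 2) ^ 2) ^ ℓ) ^ n            ≡⟨ cong (λ x → (x ^ ℓ) ^ n) (^-*-assoc n 2 2) ⟩
  ((n ^ 4) ^ ℓ) ^ n                  ≡⟨ cong (_^ n) (^-*-assoc n 4 ℓ) ⟩
  (n ^ (4 * ℓ)) ^ n                  ≡⟨ ^-*-assoc n (4 * ℓ) n ⟩
  n ^ (4 * ℓ * n)                    ∎
  where
  open ≤-Reasoning
  rank<n² : suc (n * (ℓ * 2)) ≤ n ^ 2
  rank<n² = begin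
    suc (n * (ℓ * 2))  ≤⟨ +-monoˡ-≤ (n * (ℓ * 2)) (≤-trans (s≤s z≤n) 2ℓ<n) ⟩
    n + n * (ℓ * 2)    ≡⟨ *-suc n (ℓ * 2) ⟨
    n * suc (ℓ * 2)    ≤⟨ *-monoʳ-≤ n 2ℓ<n ⟩
    n * n              ≡⟨ cong (n *_) (*-identityʳ n) ⟨
    n ^ 2              ∎

intervalGraphs-upperBound : suc (ℓ * 2) ≤ n → PowAtMost (IsIntervalGraph ℓ) n 1 (n ^ (4 * ℓ * n))
intervalGraphs-upperBound {ℓ} 2ℓ<n =
  PowAtMost-mono {𝒞 = IsIntervalGraph ℓ} (rankCodeSize≤ {ℓ} 2ℓ<n) (intervalGraphs-upperBound-rankCode {ℓ})

does≡true⇔ : {A : Set} (a? : Dec A) → does a? ≡ true ⇔ A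
does≡true⇔ (yes a) = mk⇔ (λ _ → a) (λ _ → refl)
does≡true⇔ (no ¬a) = mk⇔ (λ ()) (⊥-elim ∘ ¬a)

pointGraph : (Fin n → ℚ) → Graph n
pointGraph x = record
  { adj = λ u v → not (does (u Fin.≟ v)) ∧ does (x u ℚ.≟ x v)
  ; sym = λ u v → cong₂ (λ a b → not a ∧ b) (does-⇔ ≡-sym (u Fin.≟ v) (v Fin.≟ u))
                                             (does-⇔ ≡-sym (x u ℚ.≟ x v) (x v ℚ.≟ x u))
  ; irrefl = λ u → cong (λ a → not a ∧ does (x u ℚ.≟ x u)) (dec-true (u Fin.≟ u) refl)
  }
  where
  ≡-sym : {A : Set} {a b : A} → a ≡ b ⇔ b ≡ a
  ≡-sym = mk⇔ ≡.sym ≡.sym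

pointGraph-adj : (x : Fin n → ℚ) {u v : Fin n} → u ≢ v → adj (pointGraph x) u v ≡ true ⇔ x u ≡ x v
pointGraph-adj x {u} {v} u≢v rewrite dec-false (u Fin.≟ v) u≢v = does≡true⇔ (x u ℚ.≟ x v)

pointInterval : ℚ → Interval
pointInterval p = record { lo = p ; hi = p ; lo≤hi = ℚ.≤-refl }

Meets-pointIntervals : {p q : ℚ} → Meets {suc ℓ} (λ _ → pointInterval p) (λ _ → pointInterval q) ⇔ p ≡ q
Meets-pointIntervals = mk⇔
  (λ (z , (_ , p≤z , z≤p) , (_ , q≤z , z≤q)) → ≡.trans (ℚ.≤-antisym p≤z z≤p) (ℚ.≤-antisym z≤q q≤z))
  λ { refl → _ , (zero , ℚ.≤-refl , ℚ.≤-refl) , (zero , ℚ.≤-refl , ℚ.≤-refl) }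

pointGraph-isIntervalGraph : (x : Fin n → ℚ) → IsIntervalGraph (suc ℓ) n (pointGraph x)
pointGraph-isIntervalGraph x =
  (λ u _ → pointInterval (x u)) , λ u v u≢v → ⇔.trans (pointGraph-adj x u≢v) (⇔.sym Meets-pointIntervals)

fromFin : Fin k → ℚ
fromFin i = mkℚ+ (toℕ i) 1 (Coprime.sym (Coprime.1-coprimeTo (toℕ i)))

fromFin-injective : {i j : Fin k} → fromFin i ≡ fromFin j → i ≡ j
fromFin-injective eq = toℕ-injective (proj₁ (ℚ.mkℚ+-injective eq))

positions : (Fin m → Fin k) → Fin (m + k) → ℚ
positions {m} g = fromFin ∘ [ g , id ]′ ∘ splitAt m

positions-↑ˡ : (g : Fin m → Fin k) (j : Fin m) → positions g (j ↑ˡ k) ≡ fromFin (g j)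
positions-↑ˡ {m} {k} g j = cong (fromFin ∘ [ g , id ]′) (splitAt-↑ˡ m j k)

positions-↑ʳ : (g : Fin m → Fin k) (i : Fin k) → positions g (m ↑ʳ i) ≡ fromFin i
positions-↑ʳ {m} {k} g i = cong (fromFin ∘ [ g , id ]′) (splitAt-↑ʳ m k i)

↑ˡ≢↑ʳ : (j : Fin m) (i : Fin k) → j ↑ˡ k ≢ m ↑ʳ i
↑ˡ≢↑ʳ {m} {k} j i eq
  with ≡.trans (≡.sym (splitAt-↑ˡ m j k)) (≡.trans (cong (splitAt m) eq) (splitAt-↑ʳ m k i))
... | ()

functionGraph : (Fin m → Fin k) → Graph (m + k)
functionGraph g = pointGraph (positions g)

functionGraph-injective : (g g′ : Fin m → Fin k) → functionGraph g ≈G functionGraph g′ → g ≗ g′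
functionGraph-injective {m} {k} g g′ G≈G′ j = ≡.sym (fromFin-injective (begin
  fromFin (g′ j)      ≡⟨ positions-↑ˡ g′ j ⟨
  positions g′ u      ≡⟨ Equivalence.to (pointGraph-adj (positions g′) u≢v) adjacent′ ⟩
  positions g′ v      ≡⟨ positions-↑ʳ g′ (g j) ⟩
  fromFin (g j)       ∎))
  where
  open ≡.≡-Reasoning
  u = j ↑ˡ k
  v = m ↑ʳ g j
  u≢v = ↑ˡ≢↑ʳ j (g j)
  adjacent : adj (functionGraph g) u v ≡ true
  adjacent = Equivalence.from (pointGraph-adj (positions g) u≢v)
    (≡.trans (positions-↑ˡ g j) (≡.sym (positions-↑ʳ g (g j))))
  adjacent′ : adj (functionGraph g′) u v ≡ true
  adjacent′ = ≡.trans (≡.sym (G≈G′ u v)) adjacent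

intervalGraphs-lowerBound-functionGraphs : PowAtLeast (IsIntervalGraph (suc ℓ)) (m + k) q ((k ^ m) ^ q)
intervalGraphs-lowerBound-functionGraphs {ℓ} {m} {k} =
  PowAtLeast-fromFunctions {m} {k} {𝒞 = IsIntervalGraph (suc ℓ)} (λ g → functionGraph g , pointGraph-isIntervalGraph (positions g)) functionGraph-injective

⌈n/2⌉≤1+⌊n/2⌋ : ∀ n → ⌈ n /2⌉ ≤ suc ⌊ n /2⌋
⌈n/2⌉≤1+⌊n/2⌋ 0 = z≤n
⌈n/2⌉≤1+⌊n/2⌋ 1 = ≤-refl
⌈n/2⌉≤1+⌊n/2⌋ (suc (suc n)) = s≤s (⌈n/2⌉≤1+⌊n/2⌋ n)

balancedSplit-bound : m + k ≡ n → m ≤ k → k ≤ suc m → 1 ≤ m → 2 ≤ k → n ^ (1 * n) ≤ (k ^ m) ^ 6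
balancedSplit-bound {m} {k} {n} refl m≤k k≤1+m 1≤m 2≤k = begin
  n ^ (1 * n)  ≡⟨ cong (n ^_) (*-identityˡ n) ⟩
  n ^ n        ≤⟨ ^-monoˡ-≤ n m+k≤k² ⟩
  (k ^ 2) ^ n  ≡⟨ ^-*-assoc k 2 n ⟩
  k ^ (2 * n)  ≤⟨ ^-monoʳ-≤ k 2[m+k]≤6m ⟩
  k ^ (m * 6)  ≡⟨ ^-*-assoc k m 6 ⟨
  (k ^ m) ^ 6  ∎
  where
  open ≤-Reasoning
  instance
    k≢0 : NonZero k
    k≢0 = >-nonZero (≤-trans (s≤s z≤n) 2≤k)
  m+k≤k² : m + k ≤ k ^ 2
  m+k≤k² = begin
    m + k        ≤⟨ +-monoˡ-≤ k m≤k ⟩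
    k + k        ≡⟨ cong (k +_) (+-identityʳ k) ⟨
    2 * k        ≤⟨ *-monoˡ-≤ k 2≤k ⟩
    k * k        ≡⟨ cong (k *_) (*-identityʳ k) ⟨
    k ^ 2        ∎
  m+k≤3m : m + k ≤ 3 * m
  m+k≤3m = begin
    m + k        ≤⟨ +-monoʳ-≤ m k≤1+m ⟩
    m + suc m    ≤⟨ +-monoʳ-≤ m (+-monoˡ-≤ m 1≤m) ⟩
    m + (m + m)  ≡⟨ cong (λ x → m + (m + x)) (+-identityʳ m) ⟨
    3 * m        ∎
  2[m+k]≤6m : 2 * (m + k) ≤ m * 6
  2[m+k]≤6m = begin
    2 * (m + k)  ≤⟨ *-monoʳ-≤ 2 m+k≤3m ⟩
    2 * (3 * m)  ≡⟨ *-assoc 2 3 m ⟨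
    6 * m        ≡⟨ *-comm 6 m ⟩
    m * 6        ∎

intervalGraphs-lowerBound : 3 ≤ n → PowAtLeast (IsIntervalGraph (suc ℓ)) n 6 (n ^ (1 * n))
intervalGraphs-lowerBound {n} {ℓ} 3≤n = PowAtLeast-mono {𝒞 = IsIntervalGraph (suc ℓ)} n^n≤halves
  (subst (λ n′ → PowAtLeast (IsIntervalGraph (suc ℓ)) n′ 6 ((⌈ n /2⌉ ^ ⌊ n /2⌋) ^ 6)) halves≡n
    (intervalGraphs-lowerBound-functionGraphs {ℓ} {⌊ n /2⌋} {⌈ n /2⌉}))
  where
  halves≡n = ⌊n/2⌋+⌈n/2⌉≡n n
  n^n≤halves = balancedSplit-bound halves≡n (⌊n/2⌋≤⌈n/2⌉ n) (⌈n/2⌉≤1+⌊n/2⌋ n)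
                                   (⌊n/2⌋-mono 3≤n) (⌈n/2⌉-mono 3≤n)

corollary1 : (ℓ : ℕ) → 1 ≤ ℓ → Factorial (IsIntervalGraph ℓ)
corollary1 ℓ@(suc _) _ =
  1 , 6 , 4 * ℓ , 1 , s≤s z≤n , s≤s z≤n , s≤s z≤n , s≤s z≤n , suc (ℓ * 2) ,
  λ n 2ℓ<n → intervalGraphs-lowerBound (≤-trans (s≤s (s≤s (s≤s z≤n))) 2ℓ<n) , intervalGraphs-upperBound 2ℓ<n
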